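{- Let $p$ be a prime, let $\alpha<\beta<\gamma$ be positive integers, and let $G=\mathbb{Z}/p^{\alpha}\mathbb{Z}\times\mathbb{Z}/p^{\beta}\mathbb{Z}\times\mathbb{Z}/p^{\gamma}\mathbb{Z}$. For $(a,b,c)\in G$ the ideal $[(a,b,c):G]$ is as follows (throughout, when $c\in\mathcal{O}_{\gamma,p^i}$ with the stated range of $i$): (A) Let $a\in\mathcal{O}_{\alpha,p^{\alpha}}$. (A1) For $b\in\mathcal{O}_{\beta,p^{\beta}}$: $[(a,b,c):G]=p^{\gamma}\mathbb{Z}$ for $c\in\mathcal{O}_{\gamma,p^{\gamma}}$; $=p^{\beta}\mathbb{Z}$ for $c\in\mathcal{O}_{\gamma,p^i}$ with $0\le i\le\beta-1$; $=p^{i}\mathbb{Z}$ for $c\in\mathcal{O}_{\gamma,p^i}$ with $\beta\le i\le\gamma-1$. (A2) For $b\in\mathcal{O}_{\beta,p^j}$ with $0\le j\le\beta-1$: $[(a,b,c):G]=p^{\gamma}\mathbb{Z}$ for $c\in\mathcal{O}_{\gamma,p^{\gamma}}$; $=p^{\beta}\mathbb{Z}$ for $c\in\mathcal{O}_{\gamma,p^i}$ with $0\le i\le j$; $=p^{i+\beta-j}\mathbb{Z}$ for $c\in\mathcal{O}_{\gamma,p^i}$ with $j+1\le i\le\gamma-\beta+j$; $=p^{\gamma}\mathbb{Z}$ for $c\in\mathcal{O}_{\gamma,p^i}$ with $\gamma-\beta+j+1\le i\le\gamma-1$. (B) Let $a\in\mathcal{O}_{\alpha,p^k}$ with $0\le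 k\le\alpha-1$. (B1) For $b\in\mathcal{O}_{\beta,p^{\beta}}$: $[(a,b,c):G]=p^{\gamma}\mathbb{Z}$ for $c\in\mathcal{O}_{\gamma,p^{\gamma}}$; $=p^{\beta}\mathbb{Z}$ for $c\in\mathcal{O}_{\gamma,p^i}$ with $0\le i\le\beta-\alpha+k$; $=p^{i+\alpha-k}\mathbb{Z}$ for $c\in\mathcal{O}_{\gamma,p^i}$ with $\beta-\alpha+k+1\le i\le\gamma-\alpha+k-1$; $=p^{\gamma}\mathbb{Z}$ for $c\in\mathcal{O}_{\gamma,p^i}$ with $\gamma-\alpha+k\le i\le\gamma-1$. (B2) For $b\in\mathcal{O}_{\beta,p^j}$ with $0\le j\le\beta-1$: $[(a,b,c):G]=p^{\gamma}\mathbb{Z}$ for $c\in\mathcal{O}_{\gamma,p^{\gamma}}$; $=p^{\beta}\mathbb{Z}$ for $c\in\mathcal{O}_{\gamma,p^i}$ where $i\le j$, $0\le i\le\beta-\alpha$ and $0\le i\le\gamma-\beta+j$; $=p^{\beta+i-j}\mathbb{Z}$ where $i>j$, $0\le i\le\beta-\alpha$ and $0\le i\le\gamma-\beta+j$; $=p^{i+\beta-j}\mathbb{Z}$ where $\gamma-\beta+j\ge i\ge j$, $\beta-\alpha<i$ and $\beta-\alpha>j$; $=p^{\alpha-k+i}\mathbb{Z}$ where $\gamma-\beta+j\ge i\ge j$, $\gamma-\alpha+k>i$ and $j>\beta-\alpha+k$; $=p^{\gamma}\mathbb{Z}$ where $\gamma-\beta+j\ge i\ge j$, $\gamma-\alpha+k\le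 i$ and $j>\beta-\alpha+k$; $=p^{\beta+i-j}\mathbb{Z}$ where $\gamma-\beta+j\ge i\ge j$ and $\beta-\alpha<j\le\beta-\alpha+k$; $=p^{\beta}\mathbb{Z}$ where $i<j$, $\gamma-\beta+j\ge i>\beta-\alpha$ and $j\le\beta-\alpha+k$; $=p^{\beta}\mathbb{Z}$ where $i<j$, $\gamma-\beta+j\ge i$, $\beta-\alpha+k>i>\beta-\alpha$ and $j>\beta-\alpha+k$; $=p^{\alpha+i-k}\mathbb{Z}$ where $i<j$, $\gamma-\beta+j\ge i$ and $\gamma-\alpha+k>i\ge\beta-\alpha+k$; $=p^{\gamma}\mathbb{Z}$ where $i<j$, $\gamma-\beta+j\ge i\ge\gamma-\alpha+k$ and $j>\beta-\alpha+k$; $=p^{\gamma}\mathbb{Z}$ where $\gamma-\beta+j\le i\le\gamma-1$.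
   Context: For a finite abelian group $G$ viewed as a $\mathbb{Z}$-module and $x\in G$, $[x:G]=\{r\in\mathbb{Z} : rG\subseteq\mathbb{Z}x\}$, an ideal of $\mathbb{Z}$. For a positive integer $s$ and $0\le i\le s$, $\mathcal{O}_{s,p^i}=\{p^ib\pmod{p^s} : b\in\mathbb{Z},\ \gcd(b,p)=1\}\subseteq\mathbb{Z}/p^s\mathbb{Z}$; in particular $\mathcal{O}_{s,p^s}=\{0\}$, and these sets partition $\mathbb{Z}/p^s\mathbb{Z}$. -}

module Defs where

open import Data.Nat using (ℕ; _^_)
open import Data.Integer using (ℤ; +_; _-_; _*_; ∣_∣)
open import Data.Integer.Divisibility using (_∣_)
open import Data.Nat.Coprimality using (Coprime)
open import Data.Product using (_×_; _,_; ∃)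

_≡_[mod_] : ℤ → ℤ → ℕ → Set
x ≡ y [mod m ] = (+ m) ∣ (x - y)

-- Elements of G = ℤ/p^α × ℤ/p^β × ℤ/p^γ are represented by triples of
-- integer representatives; equality in G is componentwise congruence.
G : Set
G = ℤ × ℤ × ℤ

EqG : ℕ → ℕ → ℕ → ℕ → G → G → Set
EqG p α β γ (x₁ , x₂ , x₃) (y₁ , y₂ , y₃) =
  (x₁ ≡ y₁ [mod p ^ α ]) × (x₂ ≡ y₂ [mod p ^ β ]) × (x₃ ≡ y₃ [mod p ^ γ ])

_·_ : ℤ → G → G
r · (g₁ , g₂ , g₃) = (r * g₁ , r * g₂ , r * g₃)

InColon : ℕ → ℕ → ℕ → ℕ → G → ℤ → Set
InColon p α β γ x r = (g : G) → ∃ λ (n : ℤ) → EqG p α β γ (r · g) (n · x)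

ColonIs : ℕ → ℕ → ℕ → ℕ → G → ℕ → Set
ColonIs p α β γ x e =
  (r : ℤ) → (InColon p α β γ x r → (+ (p ^ e)) ∣ r) × ((+ (p ^ e)) ∣ r → InColon p α β γ x r)

InO : ℕ → ℕ → ℕ → ℤ → Set
InO p s i c = ∃ λ (b : ℤ) → Coprime ∣ b ∣ p × (c ≡ (+ (p ^ i)) * b [mod p ^ s ])

{-# OPTIONS --safe #-}
-- Write x = (x_α, x_β, x_γ) with x_s ≡ p^{v_s}·unit (mod p^s). For the generator e_s of the
-- coordinate of level s, r·e_s ∈ ℤx means that some n has n·x_s ≡ r and n·x_{s'} ≡ 0 for the two
-- other levels s'. The latter conditions say exactly p^{s' − v_{s'}} ∣ n, so the attainable r are
-- the multiples of p^{e_s}, e_s = min(s, v_s + max_{s'} (s' − v_{s'})), and [x : G] = p^{max_s e_s}.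
-- For α ≤ β ≤ γ this maximum is max(β, e_γ): if e_β < β then the order of x_γ exceeds that of x_β,
-- which forces e_γ = γ. Each clause of the theorem is the value of
-- max(β, min(γ, i + max(α − k, β − j))) on the corresponding range of i, j, k.
module Submission where

open import Defs
open import Data.Nat as ℕ using (ℕ; _∸_; _≤_; _⊔_; _⊓_; _^_; NonZero)
open import Data.Nat.Properties
  using ( ≤-refl; ≤-trans; ≤-total; ≤-antisym; m≤m⊔n; m≤n⊔m; m⊓n≤m; m⊓n≤n; ⊓-sel; ⊔-sel; ⊔-lub
        ; m≤n⇒m≤n⊔o; m≤n⇒m⊓n≡m; m≤n⇒m∸n≡0; m≤n+m∸n; m+n≤o⇒m≤o∸n; m+[n∸m]≡n
        ; m+n≤o⇒m≤o; +-monoʳ-≤; ^-distribˡ-+-*; m^n≢0)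
import Data.Nat.Properties as ℕₚ
import Data.Nat.Divisibility as ℕ∣
open import Data.Nat.Coprimality as Coprimality using (Coprime; coprime-divisor; coprime-Bézout)
open import Data.Nat.GCD using (module Bézout)
open import Data.Integer using (ℤ)
open import Data.Product using (_×_; _,_; ∃)
open import Data.Sum using (_⊎_; inj₁; inj₂)
open import Relation.Binary.PropositionalEquality

-- {r : r·e ∈ ℤx} = p^(generatorExponent …) ℤ for the unit vector e of the coordinate of level s,
-- where x has valuation v there and valuations v₁, v₂ in the coordinates of levels s₁, s₂.
generatorExponent : (s v s₁ v₁ s₂ v₂ : ℕ) → ℕ
generatorExponent s v s₁ v₁ s₂ v₂ = s ⊓ (v ℕ.+ ((s₁ ∸ v₁) ⊔ (s₂ ∸ v₂)))

colonExponent : (α β γ u w t : ℕ) → ℕ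
colonExponent α β γ u w t =
  generatorExponent α u β w γ t ⊔ generatorExponent β w α u γ t ⊔ generatorExponent γ t α u β w

coprime-^ : ∀ {m p} k → Coprime m p → Coprime m (p ^ k)
coprime-^ ℕ.zero    _      (_ , d∣1)      = ℕ∣.∣1⇒≡1 d∣1
coprime-^ (ℕ.suc k) m⊥p {d} (d∣m , d∣p^k⁺¹) =
  coprime-^ k m⊥p (d∣m , coprime-divisor (λ (e∣d , e∣p) → m⊥p (ℕ∣.∣-trans e∣d d∣m , e∣p)) d∣p^k⁺¹)

m⊓n≤o⇒m≤o⊎n≤o : ∀ {m n o} → m ⊓ n ≤ o → m ≤ o ⊎ n ≤ o
m⊓n≤o⇒m≤o⊎n≤o {m} {n} le with ⊓-sel m n
... | inj₁ eq = inj₁ (subst (_≤ _) eq le)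
... | inj₂ eq = inj₂ (subst (_≤ _) eq le)

module Valuation (p : ℕ) .{{p≢0 : NonZero p}} where

  open import Data.Integer using (+_; -[1+_]; -_; _+_; _-_; _*_; ∣_∣)
  open import Data.Integer.Properties using (pos-*; *-identityʳ; *-comm; +-comm; +-assoc; +-identityʳ)
  open import Data.Integer.Divisibility.Signed
    using (_∣_; divides; ∣ᵤ⇒∣; ∣⇒∣ᵤ; ∣-refl; ∣-trans; ∣m∣n⇒∣m+n; ∣m∣n⇒∣m-n; ∣m⇒∣-m; ∣n⇒∣m*n; ∣m⇒∣m*n; *-monoʳ-∣; *-cancelˡ-∣)
  import Data.Integer.Coprimality as ℤ
  open import Data.Integer.Tactic.RingSolver using (solve-∀)

  infix 8 P^_

  P^_ : ℕ → ℤ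
  P^ e = + (p ^ e)

  P^-+ : ∀ m n → P^ (m ℕ.+ n) ≡ P^ m * P^ n
  P^-+ m n = trans (cong +_ (^-distribˡ-+-* p m n)) (pos-* (p ^ m) (p ^ n))

  P^-mono-∣ : ∀ {m n} → m ≤ n → P^ m ∣ P^ n
  P^-mono-∣ {m} {n} m≤n = divides (P^ (n ∸ m)) (begin
    P^ n                 ≡⟨ cong P^_ (m+[n∸m]≡n m≤n) ⟨
    P^ (m ℕ.+ (n ∸ m))   ≡⟨ P^-+ m (n ∸ m) ⟩
    P^ m * P^ (n ∸ m)    ≡⟨ *-comm (P^ m) _ ⟩
    P^ (n ∸ m) * P^ m    ∎)
    where open ≡-Reasoning

  P^-⊔-∣ : ∀ m n {x} → P^ m ∣ x → P^ n ∣ x → P^ (m ⊔ n) ∣ x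
  P^-⊔-∣ m n m∣x n∣x with ⊔-sel m n
  ... | inj₁ eq rewrite eq = m∣x
  ... | inj₂ eq rewrite eq = n∣x

  P^-cancelˡ-∣ : ∀ m n {x} → P^ (m ℕ.+ n) ∣ P^ m * x → P^ n ∣ x
  P^-cancelˡ-∣ m n h = *-cancelˡ-∣ (P^ m) {{m^n≢0 p m}} (subst (_∣ _) (P^-+ m n) h)

  unit-cancel : ∀ s {u n} → Coprime ∣ u ∣ p → P^ s ∣ n * u → P^ s ∣ n
  unit-cancel s {u} {n} u⊥p s∣nu = ∣ᵤ⇒∣ (ℤ.coprime-divisor (P^ s) u n
    (Coprimality.sym (coprime-^ s u⊥p)) (∣⇒∣ᵤ (subst (P^ s ∣_) (*-comm n u) s∣nu)))

  natural-inverse : ∀ s {m} → Coprime m p → ∃ λ v → P^ s ∣ + m * v - + 1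
  natural-inverse s {m} m⊥p with coprime-Bézout (coprime-^ s m⊥p)
  ... | Bézout.+- x y eq = + x , divides (+ y) (begin
    + m * + x - + 1               ≡⟨ cong (_- + 1) (pos-* m x) ⟨
    + (m ℕ.* x) - + 1             ≡⟨ cong (λ z → + z - + 1) (trans (ℕₚ.*-comm m x) (sym eq)) ⟩
    + (1 ℕ.+ y ℕ.* p ^ s) - + 1   ≡⟨ cong (λ z → + 1 + z - + 1) (pos-* y (p ^ s)) ⟩
    + 1 + + y * P^ s - + 1        ≡⟨ cancel-1 (+ y * P^ s) ⟩
    + y * P^ s                    ∎)
    where
    open ≡-Reasoning
    cancel-1 : ∀ z → + 1 + z - + 1 ≡ z
    cancel-1 = solve-∀
  ... | Bézout.-+ x y eq = - + x , divides (- + y) (begin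
    + m * - + x - + 1             ≡⟨ negate (+ m) (+ x) ⟩
    - (+ 1 + + x * + m)           ≡⟨ cong (λ z → - (+ 1 + z)) (pos-* x m) ⟨
    - + (1 ℕ.+ x ℕ.* m)           ≡⟨ cong (λ z → - + z) eq ⟩
    - + (y ℕ.* p ^ s)             ≡⟨ cong -_ (pos-* y (p ^ s)) ⟩
    - (+ y * P^ s)                ≡⟨ neg-* (+ y) (P^ s) ⟩
    - + y * P^ s                  ∎)
    where
    open ≡-Reasoning
    negate : ∀ a b → a * - b - + 1 ≡ - (+ 1 + b * a)
    negate = solve-∀
    neg-* : ∀ a b → - (a * b) ≡ - a * b
    neg-* = solve-∀

  unit-inverse : ∀ s {u} → Coprime ∣ u ∣ p → ∃ λ v → P^ s ∣ u * v - + 1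
  unit-inverse s {+ m}      u⊥p = natural-inverse s u⊥p
  unit-inverse s { -[1+ m ]} u⊥p with natural-inverse s u⊥p
  ... | v , s∣ = - v , subst (P^ s ∣_) (negate-both (+ ℕ.suc m) v) s∣
    where
    negate-both : ∀ a b → a * b - + 1 ≡ - a * - b - + 1
    negate-both = solve-∀

  -- The data of InO p s v x, in a form whose indices Agda can infer (p ^_ is not injective).
  record Valued (s v : ℕ) (x : ℤ) : Set where
    constructor valued
    field
      unit           : ℤ
      unit-coprime   : Coprime ∣ unit ∣ p
      x≡P^v*unit     : P^ s ∣ x - P^ v * unit

  InO⇒Valued : ∀ s v x → InO p s v x → Valued s v x
  InO⇒Valued s v x (x' , x'⊥p , x≡) = valued x' x'⊥p (∣ᵤ⇒∣ x≡)

  valuation-∣ : ∀ {m n s v x} → P^ m ∣ n → Valued s v x → P^ (s ⊓ (v ℕ.+ m)) ∣ n * x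
  valuation-∣ {m} {n} {s} {v} {x} m∣n (valued x' _ x≡) =
    subst (_ ∣_) (split n x (P^ v) x')
      (∣m∣n⇒∣m+n (∣-trans (P^-mono-∣ (m⊓n≤m s _)) (∣n⇒∣m*n n x≡))
                 (∣-trans (P^-mono-∣ (m⊓n≤n s _)) (∣m⇒∣m*n x' v+m∣vn)))
    where
    v+m∣vn : P^ (v ℕ.+ m) ∣ P^ v * n
    v+m∣vn = subst (_∣ P^ v * n) (sym (P^-+ v m)) (*-monoʳ-∣ (P^ v) m∣n)
    split : ∀ n x a x' → n * (x - a * x') + a * n * x' ≡ n * x
    split = solve-∀

  valuation-vanishes : ∀ m {n s v x} → P^ m ∣ n → Valued s v x → s ∸ v ≤ m → P^ s ∣ n * x
  valuation-vanishes m {n} {s} {v} {x} m∣n x∈ s∸v≤m =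
    subst (λ e → P^ e ∣ n * x) (m≤n⇒m⊓n≡m s≤v+m) (valuation-∣ {m} m∣n x∈)
    where
    s≤v+m : s ≤ v ℕ.+ m
    s≤v+m = ≤-trans (m≤n+m∸n s v) (+-monoʳ-≤ v s∸v≤m)

  annihilator-∣ : ∀ n {s v y} → Valued s v y → P^ s ∣ n * y → P^ (s ∸ v) ∣ n
  annihilator-∣ n {s} {v} {y} (valued y' y'⊥p y≡) s∣ny with ≤-total v s
  ... | inj₂ s≤v rewrite m≤n⇒m∸n≡0 s≤v = divides n (sym (*-identityʳ n))
  ... | inj₁ v≤s = P^-cancelˡ-∣ v (s ∸ v) (subst (λ e → P^ e ∣ P^ v * n) (sym (m+[n∸m]≡n v≤s)) s∣vn)
    where
    rearrange : ∀ n y a y' → n * y - n * (y - a * y') ≡ a * n * y'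
    rearrange = solve-∀
    s∣vn : P^ s ∣ P^ v * n
    s∣vn = unit-cancel s y'⊥p (subst (P^ s ∣_) (rearrange n y (P^ v) y') (∣m∣n⇒∣m-n s∣ny (∣n⇒∣m*n n y≡)))

  P^-multiple : ∀ {s v f x} → Valued s v x → v ≤ f → ∃ λ n → (P^ (f ∸ v) ∣ n) × (P^ s ∣ P^ f - n * x)
  P^-multiple {s} {v} {f} {x} (valued x' x'⊥p x≡) v≤f with unit-inverse s {x'} x'⊥p
  ... | x⁻¹ , s∣x'x⁻¹-1 = P^ d * x⁻¹ , ∣m⇒∣m*n x⁻¹ ∣-refl ,
    subst (P^ s ∣_) (trans (rearrange (P^ v) (P^ d) x x' x⁻¹) (cong (_- P^ d * x⁻¹ * x) P^v*P^d≡P^f))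
      (∣m∣n⇒∣m-n (∣n⇒∣m*n (- (P^ v * P^ d)) s∣x'x⁻¹-1) (∣n⇒∣m*n (P^ d * x⁻¹) x≡))
    where
    d = f ∸ v
    P^v*P^d≡P^f : P^ v * P^ d ≡ P^ f
    P^v*P^d≡P^f = trans (sym (P^-+ v d)) (cong P^_ (m+[n∸m]≡n v≤f))
    rearrange : ∀ a b x x' x⁻¹ → - (a * b) * (x' * x⁻¹ - + 1) - b * x⁻¹ * (x - a * x') ≡ a * b - b * x⁻¹ * x
    rearrange = solve-∀

  generator-multiple : ∀ {s v s₁ v₁ s₂ v₂ f x y z} → Valued s v x → Valued s₁ v₁ y → Valued s₂ v₂ z →
    generatorExponent s v s₁ v₁ s₂ v₂ ≤ f →
    ∃ λ n → (P^ s ∣ P^ f - n * x) × (P^ s₁ ∣ n * y) × (P^ s₂ ∣ n * z)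
  generator-multiple {s} {v} {s₁} {v₁} {s₂} {v₂} {f} x∈ y∈ z∈ e≤f with m⊓n≤o⇒m≤o⊎n≤o e≤f
  ... | inj₁ s≤f = + 0 , subst (P^ s ∣_) (sym (+-identityʳ (P^ f))) (P^-mono-∣ s≤f) ,
                   divides (+ 0) refl , divides (+ 0) refl
  ... | inj₂ v+m≤f with P^-multiple x∈ (m+n≤o⇒m≤o v v+m≤f)
  ...   | n , d∣n , s∣ = n , s∣ ,
          valuation-vanishes (f ∸ v) d∣n y∈ (≤-trans (m≤m⊔n _ _) m≤f∸v) ,
          valuation-vanishes (f ∸ v) d∣n z∈ (≤-trans (m≤n⊔m _ _) m≤f∸v)
    where
    m≤f∸v : (s₁ ∸ v₁) ⊔ (s₂ ∸ v₂) ≤ f ∸ v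
    m≤f∸v = m+n≤o⇒m≤o∸n _ (subst (_≤ f) (ℕₚ.+-comm v _) v+m≤f)

  generatorExponent-∣ : ∀ {s v s₁ v₁ s₂ v₂ x y z} n r → Valued s v x → Valued s₁ v₁ y → Valued s₂ v₂ z →
    P^ s ∣ r - n * x → P^ s₁ ∣ n * y → P^ s₂ ∣ n * z → P^ (generatorExponent s v s₁ v₁ s₂ v₂) ∣ r
  generatorExponent-∣ {s} {v} {s₁} {v₁} {s₂} {v₂} {x} n r x∈ y∈ z∈ s∣r-nx s₁∣ny s₂∣nz =
    subst (_ ∣_) (minus-plus r (n * x))
      (∣m∣n⇒∣m+n (∣-trans (P^-mono-∣ (m⊓n≤m s _)) s∣r-nx)
                 (valuation-∣ {(s₁ ∸ v₁) ⊔ (s₂ ∸ v₂)}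
                   (P^-⊔-∣ (s₁ ∸ v₁) (s₂ ∸ v₂) (annihilator-∣ n y∈ s₁∣ny) (annihilator-∣ n z∈ s₂∣nz)) x∈))
    where
    minus-plus : ∀ r a → r - a + a ≡ r
    minus-plus = solve-∀

  module _ (α β γ u w t : ℕ) {a b c : ℤ} (a∈ : InO p α u a) (b∈ : InO p β w b) (c∈ : InO p γ t c) where

    private
      A = InO⇒Valued α u a a∈
      B = InO⇒Valued β w b b∈
      C = InO⇒Valued γ t c c∈
      e₁ = generatorExponent α u β w γ t
      e₂ = generatorExponent β w α u γ t
      e₃ = generatorExponent γ t α u β w

    InColon⇒∣ : ∀ r → InColon p α β γ (a , b , c) r → P^ (colonExponent α β γ u w t) ∣ r
    InColon⇒∣ r col with col (+ 1 , + 0 , + 0) | col (+ 0 , + 1 , + 0) | col (+ 0 , + 0 , + 1)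
    ... | n₁ , a₁ , b₁ , c₁ | n₂ , a₂ , b₂ , c₂ | n₃ , a₃ , b₃ , c₃ =
      P^-⊔-∣ (e₁ ⊔ e₂) e₃
        (P^-⊔-∣ e₁ e₂
          (generatorExponent-∣ n₁ r A B C (unit-coordinate α (n₁ * a) a₁) (zero-coordinate β (n₁ * b) b₁) (zero-coordinate γ (n₁ * c) c₁))
          (generatorExponent-∣ n₂ r B A C (unit-coordinate β (n₂ * b) b₂) (zero-coordinate α (n₂ * a) a₂) (zero-coordinate γ (n₂ * c) c₂)))
        (generatorExponent-∣ n₃ r C A B (unit-coordinate γ (n₃ * c) c₃) (zero-coordinate α (n₃ * a) a₃) (zero-coordinate β (n₃ * b) b₃))
      where
      unit-coordinate : ∀ s m → (r * + 1) ≡ m [mod p ^ s ] → P^ s ∣ r - m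
      unit-coordinate s m h = subst (λ z → P^ s ∣ z - m) (*-identityʳ r) (∣ᵤ⇒∣ h)
      negate : ∀ r m → - (r * + 0 - m) ≡ m
      negate = solve-∀
      zero-coordinate : ∀ s m → (r * + 0) ≡ m [mod p ^ s ] → P^ s ∣ m
      zero-coordinate s m h = subst (P^ s ∣_) (negate r m) (∣m⇒∣-m (∣ᵤ⇒∣ h))

    ∣⇒InColon : ∀ r → P^ (colonExponent α β γ u w t) ∣ r → InColon p α β γ (a , b , c) r
    ∣⇒InColon _ (divides q refl) (g₁ , g₂ , g₃)
      with generator-multiple A B C (m≤n⇒m≤n⊔o e₃ (m≤m⊔n e₁ e₂))
         | generator-multiple B A C (m≤n⇒m≤n⊔o e₃ (m≤n⊔m e₁ e₂))
         | generator-multiple C A B (m≤n⊔m (e₁ ⊔ e₂) e₃)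
    ... | n₁ , a₁ , b₁ , c₁ | n₂ , b₂ , a₂ , c₂ | n₃ , c₃ , a₃ , b₃ =
      q * (g₁ * n₁ + g₂ * n₂ + g₃ * n₃) ,
      ∣⇒∣ᵤ (combination α a q g₁ g₂ g₃ n₁ n₂ n₃ a₁ a₂ a₃) ,
      ∣⇒∣ᵤ (subst (λ N → P^ β ∣ q * P^ e * g₂ - q * N * b) (cong (_+ g₃ * n₃) (+-comm (g₂ * n₂) _))
             (combination β b q g₂ g₁ g₃ n₂ n₁ n₃ b₂ b₁ b₃)) ,
      ∣⇒∣ᵤ (subst (λ N → P^ γ ∣ q * P^ e * g₃ - q * N * c) (trans (+-assoc (g₃ * n₃) _ _) (+-comm (g₃ * n₃) _))
             (combination γ c q g₃ g₁ g₂ n₃ n₁ n₂ c₃ c₁ c₂))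
      where
      e = colonExponent α β γ u w t
      expand : ∀ q P x g g' g'' n n' n'' →
        q * (g * (P - n * x) - g' * (n' * x) - g'' * (n'' * x)) ≡ q * P * g - q * (g * n + g' * n' + g'' * n'') * x
      expand = solve-∀
      combination : ∀ s x q g g' g'' n n' n'' → P^ s ∣ P^ e - n * x → P^ s ∣ n' * x → P^ s ∣ n'' * x →
        P^ s ∣ q * P^ e * g - q * (g * n + g' * n' + g'' * n'') * x
      combination s x q g g' g'' n n' n'' h h' h'' = subst (P^ s ∣_) (expand q (P^ e) x g g' g'' n n' n'')
        (∣n⇒∣m*n q (∣m∣n⇒∣m-n (∣m∣n⇒∣m-n (∣n⇒∣m*n g h) (∣n⇒∣m*n g' h')) (∣n⇒∣m*n g'' h'')))

    colon-ideal : ColonIs p α β γ (a , b , c) (colonExponent α β γ u w t)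
    colon-ideal r = (λ col → ∣⇒∣ᵤ (InColon⇒∣ r col)) , (λ e∣r → ∣⇒InColon r (∣ᵤ⇒∣ e∣r))

open Valuation using (colon-ideal)

open import Data.Nat using (_+_; _<_; _>_; _≥_)
open import Data.Nat.Properties
  using (≤-reflexive; ⊔-identityʳ; m≥n⇒m⊔n≡m; m≤n⇒m⊔n≡n; m≥n⇒m⊓n≡n; n∸n≡0; m∸n≤m; m≤m+n; +-comm; +-assoc
        ; +-identityʳ; +-monoˡ-≤; <⇒≤; +-distribˡ-⊔; m∸n+n≡m; +-∸-assoc; +-∸-comm; m≤n+o⇒m∸n≤o)
open import Data.Nat.Primality using (Prime; prime⇒nonZero)

colonExponent-sorted : ∀ {α β γ} u w t → α ≤ β → β ≤ γ →
  colonExponent α β γ u w t ≡ β ⊔ generatorExponent γ t α u β w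
colonExponent-sorted {α} {β} {γ} u w t α≤β β≤γ = ≤-antisym
  (⊔-lub (⊔-lub (m≤n⇒m≤n⊔o e₃ (≤-trans (m⊓n≤m α _) α≤β)) (m≤n⇒m≤n⊔o e₃ (m⊓n≤m β _))) (m≤n⊔m β e₃))
  (⊔-lub β≤colonExponent (m≤n⊔m _ e₃))
  where
  e₃ = generatorExponent γ t α u β w
  -- Either e_β = β, or w + (γ ∸ t) < β, so x_γ has larger order than x_β and e_γ = γ.
  β≤colonExponent : β ≤ colonExponent α β γ u w t
  β≤colonExponent with ⊓-sel β (w + ((α ∸ u) ⊔ (γ ∸ t)))
  ... | inj₁ e₂≡β = ≤-trans (≤-reflexive (sym e₂≡β)) (m≤n⇒m≤n⊔o e₃ (m≤n⊔m _ _))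
  ... | inj₂ e₂≡X = ≤-trans β≤γ (≤-trans (≤-reflexive (sym e₃≡γ)) (m≤n⊔m _ e₃))
    where
    γ∸t≤β∸w : γ ∸ t ≤ β ∸ w
    γ∸t≤β∸w = m+n≤o⇒m≤o∸n (γ ∸ t) (subst (_≤ β) (+-comm w _)
      (≤-trans (+-monoʳ-≤ w (m≤n⊔m (α ∸ u) _)) (subst (_≤ β) e₂≡X (m⊓n≤m β _))))
    e₃≡γ : e₃ ≡ γ
    e₃≡γ = m≤n⇒m⊓n≡m (≤-trans (m≤n+m∸n γ t) (+-monoʳ-≤ t (≤-trans γ∸t≤β∸w (m≤n⊔m (α ∸ u) _))))

colon-ideal-sorted : ∀ p .{{_ : NonZero p}} {α β γ} u w t {a b c} → α ≤ β → β ≤ γ →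
  InO p α u a → InO p β w b → InO p γ t c → ColonIs p α β γ (a , b , c) (β ⊔ generatorExponent γ t α u β w)
colon-ideal-sorted p {α} {β} {γ} u w t {a} {b} {c} α≤β β≤γ a∈ b∈ c∈ =
  subst (ColonIs p α β γ (a , b , c)) (colonExponent-sorted u w t α≤β β≤γ) (colon-ideal p α β γ u w t a∈ b∈ c∈)

≤∸1⇒≤ : ∀ {m n} → m ≤ n ∸ 1 → m ≤ n
≤∸1⇒≤ {n = n} m≤n∸1 = ≤-trans m≤n∸1 (m∸n≤m n 1)

[m∸n+o]+[n∸o]≡m : ∀ {m n o} → n ≤ m → o ≤ n → m ∸ n + o + (n ∸ o) ≡ m
[m∸n+o]+[n∸o]≡m {m} {n} {o} n≤m o≤n = begin
  m ∸ n + o + (n ∸ o)    ≡⟨ +-assoc (m ∸ n) o _ ⟩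
  m ∸ n + (o + (n ∸ o))  ≡⟨ cong (m ∸ n +_) (m+[n∸m]≡n o≤n) ⟩
  m ∸ n + n              ≡⟨ m∸n+n≡m n≤m ⟩
  m                      ∎
  where open ≡-Reasoning

i≤m∸n+o⇒i+[n∸o]≤m : ∀ {i m n o} → n ≤ m → o ≤ n → i ≤ m ∸ n + o → i + (n ∸ o) ≤ m
i≤m∸n+o⇒i+[n∸o]≤m n≤m o≤n i≤ = ≤-trans (+-monoˡ-≤ _ i≤) (≤-reflexive ([m∸n+o]+[n∸o]≡m n≤m o≤n))

m∸n+o≤i⇒m≤i+[n∸o] : ∀ {i m n o} → n ≤ m → o ≤ n → m ∸ n + o ≤ i → m ≤ i + (n ∸ o)
m∸n+o≤i⇒m≤i+[n∸o] n≤m o≤n ≤i = ≤-trans (≤-reflexive (sym ([m∸n+o]+[n∸o]≡m n≤m o≤n))) (+-monoˡ-≤ _ ≤i)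

i≤j⇒i+[n∸j]≤n : ∀ {i j n} → j ≤ n → i ≤ j → i + (n ∸ j) ≤ n
i≤j⇒i+[n∸j]≤n j≤n i≤j = ≤-trans (+-monoˡ-≤ _ i≤j) (≤-reflexive (m+[n∸m]≡n j≤n))

j≤i⇒n≤i+[n∸j] : ∀ {i j n} → j ≤ n → j ≤ i → n ≤ i + (n ∸ j)
j≤i⇒n≤i+[n∸j] j≤n j≤i = ≤-trans (≤-reflexive (sym (m+[n∸m]≡n j≤n))) (+-monoˡ-≤ _ j≤i)

module Evaluation {α β γ : ℕ} (α≤β : α ≤ β) (β≤γ : β ≤ γ) where

  exponent : (u w t : ℕ) → ℕ
  exponent u w t = β ⊔ generatorExponent γ t α u β w

  -- p ^ maxOrder u w is the larger of the orders of a and b.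
  maxOrder : (u w : ℕ) → ℕ
  maxOrder u w = (α ∸ u) ⊔ (β ∸ w)

  α≤γ : α ≤ γ
  α≤γ = ≤-trans α≤β β≤γ

  exponent-low : ∀ u w t → t + maxOrder u w ≤ β → exponent u w t ≡ β
  exponent-low _ _ _ t+m≤β = m≥n⇒m⊔n≡m (≤-trans (m⊓n≤n γ _) t+m≤β)

  exponent-mid : ∀ u w t {m} → maxOrder u w ≡ m → β ≤ t + m → t + m ≤ γ → exponent u w t ≡ t + m
  exponent-mid _ _ _ refl β≤t+m t+m≤γ = trans (cong (β ⊔_) (m≥n⇒m⊓n≡n t+m≤γ)) (m≤n⇒m⊔n≡n β≤t+m)

  exponent-high : ∀ u w t → γ ≤ t + maxOrder u w → exponent u w t ≡ γ
  exponent-high _ _ _ γ≤t+m = trans (cong (β ⊔_) (m≤n⇒m⊓n≡m γ≤t+m)) (m≤n⇒m⊔n≡n β≤γ)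

  exponent-c≡0 : ∀ u w → exponent u w γ ≡ γ
  exponent-c≡0 u w = exponent-high u w γ (m≤m+n γ _)

  maxOrder-a≡0 : ∀ w → maxOrder α w ≡ β ∸ w
  maxOrder-a≡0 w = cong (_⊔ (β ∸ w)) (n∸n≡0 α)

  maxOrder-b≡0 : ∀ u → maxOrder u β ≡ α ∸ u
  maxOrder-b≡0 u = trans (cong ((α ∸ u) ⊔_) (n∸n≡0 β)) (⊔-identityʳ (α ∸ u))

  maxOrder-by-b : ∀ {k j} → k ≤ α → j ≤ β ∸ α + k → maxOrder k j ≡ β ∸ j
  maxOrder-by-b {k} {j} k≤α j≤ = m≤n⇒m⊔n≡n (m+n≤o⇒m≤o∸n (α ∸ k)
    (subst (_≤ β) (+-comm j (α ∸ k)) (i≤m∸n+o⇒i+[n∸o]≤m α≤β k≤α j≤)))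

  maxOrder-by-a : ∀ {k j} → k ≤ α → β ∸ α + k ≤ j → maxOrder k j ≡ α ∸ k
  maxOrder-by-a {k} {j} k≤α ≤j = m≥n⇒m⊔n≡m (m≤n+o⇒m∸n≤o β j (m∸n+o≤i⇒m≤i+[n∸o] α≤β k≤α ≤j))

  exponent-low-b : ∀ u {j i} → maxOrder u j ≡ β ∸ j → j ≤ β → i ≤ j → exponent u j i ≡ β
  exponent-low-b u {j} {i} d≡ j≤β i≤j =
    exponent-low u j i (subst (λ m → i + m ≤ β) (sym d≡) (i≤j⇒i+[n∸j]≤n j≤β i≤j))

  exponent-low-a : ∀ w {k i} → maxOrder k w ≡ α ∸ k → k ≤ α → i ≤ β ∸ α + k → exponent k w i ≡ β
  exponent-low-a w {k} {i} d≡ k≤α i≤ =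
    exponent-low k w i (subst (λ m → i + m ≤ β) (sym d≡) (i≤m∸n+o⇒i+[n∸o]≤m α≤β k≤α i≤))

  exponent-mid-b : ∀ u {j i} → maxOrder u j ≡ β ∸ j → j ≤ β → j ≤ i → i ≤ γ ∸ β + j →
    exponent u j i ≡ i + (β ∸ j)
  exponent-mid-b u {j} {i} d≡ j≤β j≤i i≤ =
    exponent-mid u j i d≡ (j≤i⇒n≤i+[n∸j] j≤β j≤i) (i≤m∸n+o⇒i+[n∸o]≤m β≤γ j≤β i≤)

  exponent-mid-a : ∀ w {k i} → maxOrder k w ≡ α ∸ k → k ≤ α → β ∸ α + k ≤ i → i ≤ γ ∸ α + k →
    exponent k w i ≡ i + (α ∸ k)
  exponent-mid-a w {k} {i} d≡ k≤α ≤i i≤ =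
    exponent-mid k w i d≡ (m∸n+o≤i⇒m≤i+[n∸o] α≤β k≤α ≤i) (i≤m∸n+o⇒i+[n∸o]≤m α≤γ k≤α i≤)

  exponent-high-b : ∀ u {j i} → j ≤ β → γ ∸ β + j ≤ i → exponent u j i ≡ γ
  exponent-high-b u {j} {i} j≤β ≤i =
    exponent-high u j i (≤-trans (m∸n+o≤i⇒m≤i+[n∸o] β≤γ j≤β ≤i) (+-monoʳ-≤ i (m≤n⊔m (α ∸ u) (β ∸ j))))

  exponent-high-a : ∀ w {k i} → k ≤ α → γ ∸ α + k ≤ i → exponent k w i ≡ γ
  exponent-high-a w {k} {i} k≤α ≤i =
    exponent-high k w i (≤-trans (m∸n+o≤i⇒m≤i+[n∸o] α≤γ k≤α ≤i) (+-monoʳ-≤ i (m≤m⊔n (α ∸ k) (β ∸ w))))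

  -- case-x of module P is clause x (a, b, c, … in order) of part (P) of the theorem.
  module A1 where

    case-b : ∀ {i} → i ≤ β ∸ 1 → exponent α β i ≡ β
    case-b i≤ = exponent-low-b α (maxOrder-a≡0 β) ≤-refl (≤∸1⇒≤ i≤)

    case-c : ∀ {i} → β ≤ i → i ≤ γ ∸ 1 → exponent α β i ≡ i
    case-c {i} β≤i i≤ = trans
      (exponent-mid-b α (maxOrder-a≡0 β) ≤-refl β≤i (subst (i ≤_) (sym (m∸n+n≡m β≤γ)) (≤∸1⇒≤ i≤)))
      (trans (cong (i +_) (n∸n≡0 β)) (+-identityʳ i))

  module A2 {j : ℕ} (j≤β : j ≤ β) where

    case-c : ∀ {i} → j + 1 ≤ i → i ≤ γ ∸ β + j → exponent α j i ≡ i + β ∸ j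
    case-c {i} j<i i≤ =
      trans (exponent-mid-b α (maxOrder-a≡0 j) j≤β (m+n≤o⇒m≤o j j<i) i≤) (sym (+-∸-assoc i j≤β))

  module B1 {k : ℕ} (k≤α : k ≤ α) where

    case-c : ∀ {i} → β ∸ α + k + 1 ≤ i → i ≤ γ ∸ α + k ∸ 1 → exponent k β i ≡ i + α ∸ k
    case-c {i} <i i≤ = trans
      (exponent-mid-a β (maxOrder-b≡0 k) k≤α (m+n≤o⇒m≤o (β ∸ α + k) <i) (≤∸1⇒≤ i≤))
      (sym (+-∸-assoc i k≤α))

  module B2 {k j : ℕ} (k≤α : k ≤ α) (j≤β : j ≤ β) where

    β+i∸j≡i+[β∸j] : ∀ i → β + i ∸ j ≡ i + (β ∸ j)
    β+i∸j≡i+[β∸j] i = trans (+-∸-comm i j≤β) (+-comm (β ∸ j) i)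

    j≤β∸α⇒maxOrder-by-b : j ≤ β ∸ α → maxOrder k j ≡ β ∸ j
    j≤β∸α⇒maxOrder-by-b j≤ = maxOrder-by-b k≤α (≤-trans j≤ (m≤m+n (β ∸ α) k))

    case-b : ∀ {i} → i ≤ j → i ≤ β ∸ α → exponent k j i ≡ β
    case-b {i} i≤j i≤β∸α = exponent-low k j i (subst (_≤ β) (sym (+-distribˡ-⊔ i (α ∸ k) (β ∸ j)))
      (⊔-lub (i≤m∸n+o⇒i+[n∸o]≤m α≤β k≤α (≤-trans i≤β∸α (m≤m+n (β ∸ α) k))) (i≤j⇒i+[n∸j]≤n j≤β i≤j)))

    case-c : ∀ {i} → i > j → i ≤ β ∸ α → i ≤ γ ∸ β + j → exponent k j i ≡ β + i ∸ j
    case-c {i} j<i i≤β∸α i≤ = trans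
      (exponent-mid-b k (j≤β∸α⇒maxOrder-by-b (≤-trans (<⇒≤ j<i) i≤β∸α)) j≤β (<⇒≤ j<i) i≤)
      (sym (β+i∸j≡i+[β∸j] i))

    case-d : ∀ {i} → γ ∸ β + j ≥ i → i ≥ j → β ∸ α > j → exponent k j i ≡ i + β ∸ j
    case-d {i} i≤ j≤i j<β∸α = trans
      (exponent-mid-b k (j≤β∸α⇒maxOrder-by-b (<⇒≤ j<β∸α)) j≤β j≤i i≤) (sym (+-∸-assoc i j≤β))

    case-e : ∀ {i} → i ≥ j → γ ∸ α + k > i → j > β ∸ α + k → exponent k j i ≡ α ∸ k + i
    case-e {i} j≤i i< <j = trans
      (exponent-mid-a j (maxOrder-by-a k≤α (<⇒≤ <j)) k≤α (≤-trans (<⇒≤ <j) j≤i) (<⇒≤ i<))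
      (+-comm i (α ∸ k))

    case-g : ∀ {i} → γ ∸ β + j ≥ i → i ≥ j → j ≤ β ∸ α + k → exponent k j i ≡ β + i ∸ j
    case-g {i} i≤ j≤i j≤ =
      trans (exponent-mid-b k (maxOrder-by-b k≤α j≤) j≤β j≤i i≤) (sym (β+i∸j≡i+[β∸j] i))

    case-h : ∀ {i} → i < j → j ≤ β ∸ α + k → exponent k j i ≡ β
    case-h i<j j≤ = exponent-low-b k (maxOrder-by-b k≤α j≤) j≤β (<⇒≤ i<j)

    case-i : ∀ {i} → β ∸ α + k > i → j > β ∸ α + k → exponent k j i ≡ β
    case-i i< <j = exponent-low-a j (maxOrder-by-a k≤α (<⇒≤ <j)) k≤α (<⇒≤ i<)

    case-j : ∀ {i} → i < j → γ ∸ α + k > i → i ≥ β ∸ α + k → exponent k j i ≡ α + i ∸ k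
    case-j {i} i<j i< ≤i = trans
      (exponent-mid-a j (maxOrder-by-a k≤α (≤-trans ≤i (<⇒≤ i<j))) k≤α ≤i (<⇒≤ i<))
      (sym (trans (+-∸-comm i k≤α) (+-comm (α ∸ k) i)))

theorem3 : (p α β γ : ℕ) → Prime p → 0 < α → α < β → β < γ → (a b c : ℤ) →
  let O = InO p
      I = ColonIs p α β γ (a , b , c)
  in
  -- (A1)
  ((O α α a → O β β b →
      (O γ γ c → I γ)
    × (∀ i → i ≤ β ∸ 1 → O γ i c → I β)
    × (∀ i → β ≤ i → i ≤ γ ∸ 1 → O γ i c → I i))
  -- (A2)
  × (∀ j → j ≤ β ∸ 1 → O α α a → O β j b →
      (O γ γ c → I γ)
    × (∀ i → i ≤ j → O γ i c → I β)
    × (∀ i → j + 1 ≤ i → i ≤ γ ∸ β + j → O γ i c → I (i + β ∸ j))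
    × (∀ i → γ ∸ β + j + 1 ≤ i → i ≤ γ ∸ 1 → O γ i c → I γ))
  -- (B1)
  × (∀ k → k ≤ α ∸ 1 → O α k a → O β β b →
      (O γ γ c → I γ)
    × (∀ i → i ≤ β ∸ α + k → O γ i c → I β)
    × (∀ i → β ∸ α + k + 1 ≤ i → i ≤ γ ∸ α + k ∸ 1 → O γ i c → I (i + α ∸ k))
    × (∀ i → γ ∸ α + k ≤ i → i ≤ γ ∸ 1 → O γ i c → I γ))
  -- (B2)
  × (∀ k j → k ≤ α ∸ 1 → j ≤ β ∸ 1 → O α k a → O β j b →
      (O γ γ c → I γ)
    × (∀ i → i ≤ j → i ≤ β ∸ α → i ≤ γ ∸ β + j → O γ i c → I β)
    × (∀ i → i > j → i ≤ β ∸ α → i ≤ γ ∸ β + j → O γ i c → I (β + i ∸ j))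
    × (∀ i → γ ∸ β + j ≥ i → i ≥ j → β ∸ α < i → β ∸ α > j → O γ i c → I (i + β ∸ j))
    × (∀ i → γ ∸ β + j ≥ i → i ≥ j → γ ∸ α + k > i → j > β ∸ α + k → O γ i c → I (α ∸ k + i))
    × (∀ i → γ ∸ β + j ≥ i → i ≥ j → γ ∸ α + k ≤ i → j > β ∸ α + k → O γ i c → I γ)
    × (∀ i → γ ∸ β + j ≥ i → i ≥ j → β ∸ α < j → j ≤ β ∸ α + k → O γ i c → I (β + i ∸ j))
    × (∀ i → i < j → γ ∸ β + j ≥ i → i > β ∸ α → j ≤ β ∸ α + k → O γ i c → I β)
    × (∀ i → i < j → γ ∸ β + j ≥ i → β ∸ α + k > i → i > β ∸ α → j > β ∸ α + k → O γ i c → I β)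
    × (∀ i → i < j → γ ∸ β + j ≥ i → γ ∸ α + k > i → i ≥ β ∸ α + k → O γ i c → I (α + i ∸ k))
    × (∀ i → i < j → γ ∸ β + j ≥ i → i ≥ γ ∸ α + k → j > β ∸ α + k → O γ i c → I γ)
    × (∀ i → γ ∸ β + j ≤ i → i ≤ γ ∸ 1 → O γ i c → I γ)))
theorem3 p α β γ p-prime _ α<β β<γ a b c =
    (λ a∈ b∈ →
        (λ c∈ → colon α β γ a∈ b∈ c∈ (exponent-c≡0 α β))
      , (λ i i≤ c∈ → colon α β i a∈ b∈ c∈ (A1.case-b i≤))
      , (λ i β≤i i≤ c∈ → colon α β i a∈ b∈ c∈ (A1.case-c β≤i i≤)))
  , (λ j hj a∈ b∈ →
      let j≤β = ≤∸1⇒≤ hj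
          open A2 j≤β
      in
        (λ c∈ → colon α j γ a∈ b∈ c∈ (exponent-c≡0 α j))
      , (λ i i≤j c∈ → colon α j i a∈ b∈ c∈ (exponent-low-b α (maxOrder-a≡0 j) j≤β i≤j))
      , (λ i j<i i≤ c∈ → colon α j i a∈ b∈ c∈ (case-c j<i i≤))
      , (λ i <i _ c∈ → colon α j i a∈ b∈ c∈ (exponent-high-b α j≤β (m+n≤o⇒m≤o (γ ∸ β + j) <i))))
  , (λ k hk a∈ b∈ →
      let k≤α = ≤∸1⇒≤ hk
          open B1 k≤α
      in
        (λ c∈ → colon k β γ a∈ b∈ c∈ (exponent-c≡0 k β))
      , (λ i i≤ c∈ → colon k β i a∈ b∈ c∈ (exponent-low-a β (maxOrder-b≡0 k) k≤α i≤))
      , (λ i <i i≤ c∈ → colon k β i a∈ b∈ c∈ (case-c <i i≤))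
      , (λ i ≤i _ c∈ → colon k β i a∈ b∈ c∈ (exponent-high-a β k≤α ≤i)))
  , (λ k j hk hj a∈ b∈ →
      let k≤α = ≤∸1⇒≤ hk
          j≤β = ≤∸1⇒≤ hj
          open B2 k≤α j≤β
      in
        (λ c∈ → colon k j γ a∈ b∈ c∈ (exponent-c≡0 k j))
      , (λ i i≤j i≤ _ c∈ → colon k j i a∈ b∈ c∈ (case-b i≤j i≤))
      , (λ i j<i i≤ i≤′ c∈ → colon k j i a∈ b∈ c∈ (case-c j<i i≤ i≤′))
      , (λ i i≤ j≤i _ j< c∈ → colon k j i a∈ b∈ c∈ (case-d i≤ j≤i j<))
      , (λ i _ j≤i i< <j c∈ → colon k j i a∈ b∈ c∈ (case-e j≤i i< <j))
      , (λ i _ _ ≤i _ c∈ → colon k j i a∈ b∈ c∈ (exponent-high-a j k≤α ≤i))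
      , (λ i i≤ j≤i _ j≤ c∈ → colon k j i a∈ b∈ c∈ (case-g i≤ j≤i j≤))
      , (λ i i<j _ _ j≤ c∈ → colon k j i a∈ b∈ c∈ (case-h i<j j≤))
      , (λ i _ _ i< _ <j c∈ → colon k j i a∈ b∈ c∈ (case-i i< <j))
      , (λ i i<j _ i< ≤i c∈ → colon k j i a∈ b∈ c∈ (case-j i<j i< ≤i))
      , (λ i _ _ ≤i _ c∈ → colon k j i a∈ b∈ c∈ (exponent-high-a j k≤α ≤i))
      , (λ i ≤i _ c∈ → colon k j i a∈ b∈ c∈ (exponent-high-b k j≤β ≤i)))
  where
  α≤β = <⇒≤ α<β
  β≤γ = <⇒≤ β<γ
  open Evaluation α≤β β≤γ
  colon : ∀ u w t {e} → InO p α u a → InO p β w b → InO p γ t c → exponent u w t ≡ e →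
    ColonIs p α β γ (a , b , c) e
  colon u w t a∈ b∈ c∈ refl = colon-ideal-sorted p {{prime⇒nonZero p-prime}} u w t α≤β β≤γ a∈ b∈ c∈
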